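{- Let $n\ge 3$. If $w\in\widetilde{S}_n$ avoids the patterns $3412$ and $4231$, then $\ell(w)\le 2\binom{n}{2}$.
   Context: $\widetilde{S}_n$ is the set of bijections $w:\mathbb{Z}\to\mathbb{Z}$ with $w(i+n)=w(i)+n$ and $\sum_{i=1}^n w(i)=\binom{n+1}{2}$; $\ell(w)=\#\{(a,b):1\le a\le n,\ a<b,\ w(a)>w(b)\}$ is its Coxeter length. $w$ avoids $p\in S_k$ if there are no integers $i_1<\dots<i_k$ with $w(i_1),\dots,w(i_k)$ in the same relative order as $p$. -}

module Defs where

open import Data.Nat as ℕ using (ℕ; zero; suc)
open import Data.Nat.Combinatorics using (_C_)
open import Data.Integer as ℤ using (ℤ; +_)
open import Data.Fin as Fin using (Fin)
open import Data.Vec using (Vec; lookup; _∷_; [])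
open import Data.List using (List; length)
open import Data.List.Relation.Unary.All using (All)
open import Data.List.Relation.Unary.Unique.Propositional using (Unique)
open import Data.Product using (Σ; _×_; _,_)
open import Relation.Binary.PropositionalEquality using (_≡_)
open import Relation.Nullary using (¬_)
open import Function.Definitions using (Bijective)

sumTo : ℕ → (ℤ → ℤ) → ℤ
sumTo zero    f = + 0
sumTo (suc m) f = sumTo m f ℤ.+ f (+ suc m)

record IsAffinePerm (n : ℕ) (w : ℤ → ℤ) : Set where
  field
    bijective : Bijective _≡_ _≡_ w
    periodic  : ∀ i → w (i ℤ.+ + n) ≡ w i ℤ.+ + n
    window    : sumTo n w ≡ + (suc n C 2)

IsInversion : ℕ → (ℤ → ℤ) → ℤ × ℤ → Set
IsInversion n w (a , b) =
  (+ 1 ℤ.≤ a) × (a ℤ.≤ + n) × (a ℤ.< b) × (w b ℤ.< w a)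

-- ℓ(w) ≤ K: the set of inversions has at most K elements, i.e. every
-- duplicate-free list of inversions has length at most K.
LengthAtMost : ℕ → (ℤ → ℤ) → ℕ → Set
LengthAtMost n w K =
  ∀ (xs : List (ℤ × ℤ)) → Unique xs → All (IsInversion n w) xs → length xs ℕ.≤ K

-- w contains the pattern p ∈ S_k (given by its one-line notation p(1)…p(k)):
-- there are integers i₁ < … < i_k with w(i₁),…,w(i_k) in the same
-- relative order as p(1),…,p(k).
Contains : {k : ℕ} → Vec ℕ k → (ℤ → ℤ) → Set
Contains {k} p w =
  Σ (Fin k → ℤ) λ idx →
    (∀ j l → j Fin.< l → idx j ℤ.< idx l) ×
    (∀ j l → (lookup p j ℕ.< lookup p l → w (idx j) ℤ.< w (idx l)) ×
             (w (idx j) ℤ.< w (idx l) → lookup p j ℕ.< lookup p l))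

Avoids : {k : ℕ} → Vec ℕ k → (ℤ → ℤ) → Set
Avoids p w = ¬ Contains p w

p3412 : Vec ℕ 4
p3412 = 3 ∷ 4 ∷ 1 ∷ 2 ∷ []

p4231 : Vec ℕ 4
p4231 = 4 ∷ 2 ∷ 3 ∷ 1 ∷ []

-- Write an inversion (a, b) of w, 1 ≤ a ≤ n, as a = 1 + A and b = 1 + s + q n with residues
-- A, s < n. Periodicity forbids A = s and forbids inversions with residue pairs (A, s) and (s, A)
-- at the same time, while 3412-avoidance bounds the span: b < a + 2n, since otherwise a, a + n,
-- b − n, b carry the pattern. So for each ordered residue pair q is pinned down by whether the
-- inversion spans less or more than one period, and swapping the pair in the second case gives an
-- injection into the n (n − 1) = 2 C(n, 2) ordered pairs of distinct residues.
module Submission where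

open import Defs
open import Data.Nat using (ℕ; zero; suc; _+_; _*_; _≤_; _<_; z≤n; s≤s; _≤?_; _<?_; NonZero)
import Data.Nat.Properties as ℕP
open import Data.Nat.Combinatorics using (_C_; nC1≡n; nCk+nC[k+1]≡[n+1]C[k+1])
open import Data.Nat.DivMod using (_%_; _/_; m≡m%n+[m/n]*n; m%n<n; [m+kn]%n≡m%n; m<n⇒m%n≡m)
open import Data.Integer as ℤ using (ℤ; +_; +<+; +≤+)
import Data.Integer.Properties as ℤP
open import Data.Fin as Fin using (Fin; zero; suc; fromℕ<; combine; punchOut)
import Data.Fin.Properties as FinP
open import Data.List using (List; []; _∷_; length; lookup)
open import Data.List.Membership.Propositional.Properties using (∈-lookup)
open import Data.List.Relation.Unary.All as All using (All)
open import Data.List.Relation.Unary.AllPairs using (_∷_)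
open import Data.List.Relation.Unary.Unique.Propositional using (Unique)
open import Data.Vec as Vec using (Vec)
open import Data.Product using (_×_; _,_)
open import Data.Sum using (inj₁; inj₂)
open import Function using (_∘_)
open import Relation.Binary.Core using (_Preserves_⟶_)
open import Relation.Binary.Definitions using (tri<; tri≈; tri>)
open import Relation.Binary.PropositionalEquality
open import Relation.Nullary using (¬_; yes; no; contradiction)

lookup-injective : ∀ {A : Set} {xs : List A} → Unique xs →
  ∀ {i j} → i Fin.< j → lookup xs i ≢ lookup xs j
lookup-injective {xs = _ ∷ _} (x∉xs ∷ _) {zero} {suc j} _ = All.lookup x∉xs (∈-lookup j)
lookup-injective {xs = _ ∷ _} (_ ∷ unique) {suc i} {suc j} (s≤s i<j) = lookup-injective unique i<j

length≤-of-injection : ∀ {A : Set} {P : A → Set} {K} (code : ∀ x → P x → Fin K) →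
  (∀ {x y} px py → code x px ≡ code y py → x ≡ y) →
  ∀ xs → Unique xs → All P xs → length xs ≤ K
length≤-of-injection {K = K} code code-injective xs unique pxs with length xs ≤? K
... | yes ≤K = ≤K
... | no ≰K =
  let i , j , i<j , codes≡ = FinP.pigeonhole (ℕP.≰⇒> ≰K) (λ i → code _ (All.lookup pxs (∈-lookup i)))
  in contradiction (code-injective _ _ codes≡) (lookup-injective unique i<j)

pairIndex : ∀ {m x y} → x < suc m → y < suc m → x ≢ y → Fin (suc m * m)
pairIndex {x = x} {y} x<n y<n x≢y =
  combine (fromℕ< x<n) (punchOut (x≢y ∘ FinP.fromℕ<-injective x y x<n y<n))

pairIndex-injective : ∀ {m x y x′ y′} (x<n : x < suc m) (y<n : y < suc m) (x≢y : x ≢ y)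
  (x′<n : x′ < suc m) (y′<n : y′ < suc m) (x′≢y′ : x′ ≢ y′) →
  pairIndex x<n y<n x≢y ≡ pairIndex x′<n y′<n x′≢y′ → x ≡ x′ × y ≡ y′
pairIndex-injective {x = x} {y} {x′} {y′} x<n y<n x≢y x′<n y′<n x′≢y′ eq
  with FinP.combine-injective _ _ _ _ eq
... | x≡x′ , j≡j′ with FinP.fromℕ<-injective x x′ x<n x′<n x≡x′
... | refl = refl , FinP.fromℕ<-injective y y′ y<n y′<n
  (FinP.punchOut-injective (x≢y ∘ FinP.fromℕ<-injective x y x<n y<n)
                           (x′≢y′ ∘ FinP.fromℕ<-injective x y′ x′<n y′<n) j≡j′)

2*[1+m]C2≡[1+m]*m : ∀ m → 2 * (suc m C 2) ≡ suc m * m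
2*[1+m]C2≡[1+m]*m zero    = refl
2*[1+m]C2≡[1+m]*m (suc m) = begin
  2 * (suc (suc m) C 2)              ≡⟨ cong (2 *_) (nCk+nC[k+1]≡[n+1]C[k+1] (suc m) 1) ⟨
  2 * (suc m C 1 + suc m C 2)        ≡⟨ ℕP.*-distribˡ-+ 2 (suc m C 1) (suc m C 2) ⟩
  2 * (suc m C 1) + 2 * (suc m C 2)  ≡⟨ cong₂ (λ a b → 2 * a + b) (nC1≡n (suc m)) (2*[1+m]C2≡[1+m]*m m) ⟩
  2 * suc m + suc m * m              ≡⟨ solve (m ∷ []) ⟩
  suc (suc m) * suc m                ∎
  where open ≡-Reasoning
        open import Data.Nat.Tactic.RingSolver using (solve)

residue-injective : ∀ {n s s′} q q′ .{{_ : NonZero n}} → s < n → s′ < n →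
  s + q * n ≡ s′ + q′ * n → s ≡ s′
residue-injective {n} {s} {s′} q q′ s<n s′<n eq = begin
  s                ≡⟨ m<n⇒m%n≡m s<n ⟨
  s % n            ≡⟨ [m+kn]%n≡m%n s q n ⟨
  (s + q * n) % n  ≡⟨ cong (_% n) eq ⟩
  (s′ + q′ * n) % n ≡⟨ [m+kn]%n≡m%n s′ q′ n ⟩
  s′ % n           ≡⟨ m<n⇒m%n≡m s′<n ⟩
  s′               ∎
  where open ≡-Reasoning

window-escape : ∀ {n c s q q′} → c ≤ s + q * n → q < q′ → c + n ≤ s + q′ * n
window-escape {n} {c} {s} {q} {q′} c≤x q<q′ = begin
  c + n           ≤⟨ ℕP.+-monoˡ-≤ n c≤x ⟩
  s + q * n + n   ≡⟨ ℕP.+-assoc s (q * n) n ⟩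
  s + (q * n + n) ≡⟨ cong (λ t → s + t) (ℕP.+-comm (q * n) n) ⟩
  s + suc q * n   ≤⟨ ℕP.+-monoʳ-≤ s (ℕP.*-monoˡ-≤ n q<q′) ⟩
  s + q′ * n      ∎
  where open ℕP.≤-Reasoning

quotient-unique-in-window : ∀ {n c s q q′} →
  c ≤ s + q * n → s + q * n < c + n → c ≤ s + q′ * n → s + q′ * n < c + n → q ≡ q′
quotient-unique-in-window {q = q} {q′} c≤x x<c+n c≤x′ x′<c+n with ℕP.<-cmp q q′
... | tri< q<q′ _ _ = contradiction x′<c+n (ℕP.≤⇒≯ (window-escape c≤x q<q′))
... | tri≈ _ q≡q′ _ = q≡q′
... | tri> _ _ q′<q = contradiction x<c+n (ℕP.≤⇒≯ (window-escape c≤x′ q′<q))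

periodic-multiple : ∀ {n} {w : ℤ → ℤ} → (∀ i → w (i ℤ.+ + n) ≡ w i ℤ.+ + n) →
  ∀ q i → w (i ℤ.+ + (q * n)) ≡ w i ℤ.+ + (q * n)
periodic-multiple {n} {w} periodic zero i =
  trans (cong w (ℤP.+-identityʳ i)) (sym (ℤP.+-identityʳ (w i)))
periodic-multiple {n} {w} periodic (suc q) i = begin
  w (i ℤ.+ + (n + q * n))         ≡⟨ cong w (shift-assoc i) ⟩
  w (i ℤ.+ + (q * n) ℤ.+ + n)     ≡⟨ periodic _ ⟩
  w (i ℤ.+ + (q * n)) ℤ.+ + n     ≡⟨ cong (ℤ._+ + n) (periodic-multiple {w = w} periodic q i) ⟩
  w i ℤ.+ + (q * n) ℤ.+ + n       ≡⟨ shift-assoc (w i) ⟨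
  w i ℤ.+ + (n + q * n)           ∎
  where
  open ≡-Reasoning
  shift-assoc : ∀ j → j ℤ.+ + (n + q * n) ≡ j ℤ.+ + (q * n) ℤ.+ + n
  shift-assoc j = trans (cong (λ t → j ℤ.+ t) (ℤP.+-comm (+ n) (+ (q * n)))) (sym (ℤP.+-assoc j _ _))

preserves-<-of-step : (f : ℕ → ℤ) → (∀ t → f t ℤ.< f (suc t)) → f Preserves _<_ ⟶ ℤ._<_
preserves-<-of-step f step {t} {suc u} (s≤s t≤u) with ℕP.m≤n⇒m<n∨m≡n t≤u
... | inj₁ t<u  = ℤP.<-trans (preserves-<-of-step f step t<u) (step u)
... | inj₂ refl = step t

preserves-<-reflects-< : ∀ {f : ℕ → ℤ} → f Preserves _<_ ⟶ ℤ._<_ →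
  ∀ {t u} → f t ℤ.< f u → t < u
preserves-<-reflects-< {f} f-mono {t} {u} ft<fu with ℕP.<-cmp t u
... | tri< t<u _ _ = t<u
... | tri≈ _ refl _ = contradiction ft<fu (ℤP.<-irrefl refl)
... | tri> _ _ u<t = contradiction ft<fu (ℤP.<-asym (f-mono u<t))

contains-of-monotone : ∀ {k} (p : Vec ℕ k) (w : ℤ → ℤ) (pos val : ℕ → ℤ) →
  pos Preserves _<_ ⟶ ℤ._<_ → val Preserves _<_ ⟶ ℤ._<_ →
  (∀ j → w (pos (Fin.toℕ j)) ≡ val (Vec.lookup p j)) → Contains p w
contains-of-monotone p w pos val pos-mono val-mono w∘pos≡val∘p =
  pos ∘ Fin.toℕ , (λ _ _ → pos-mono) , λ j l →
    (λ pj<pl → subst₂ ℤ._<_ (sym (w∘pos≡val∘p j)) (sym (w∘pos≡val∘p l)) (val-mono pj<pl)) ,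
    (λ wj<wl → preserves-<-reflects-< val-mono
                 (subst₂ ℤ._<_ (w∘pos≡val∘p j) (w∘pos≡val∘p l) wj<wl))

i<suc[i] : ∀ i → i ℤ.< ℤ.suc i
i<suc[i] i = ℤP.suc[i]≤j⇒i<j ℤP.≤-refl

contains-3412 : ∀ (w : ℤ → ℤ) {i₀ i₁ i₂ i₃} → i₀ ℤ.< i₁ → i₁ ℤ.< i₂ → i₂ ℤ.< i₃ →
  w i₂ ℤ.< w i₃ → w i₃ ℤ.< w i₀ → w i₀ ℤ.< w i₁ → Contains p3412 w
contains-3412 w {i₀} {i₁} {i₂} {i₃} i₀<i₁ i₁<i₂ i₂<i₃ w₂<w₃ w₃<w₀ w₀<w₁ =
  contains-of-monotone p3412 w pos val
    (preserves-<-of-step pos pos-step)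
    (preserves-<-of-step val val-step)
    λ { zero → refl ; (suc zero) → refl ; (suc (suc zero)) → refl ; (suc (suc (suc zero))) → refl }
  where
  -- The occurrence's positions and its values in increasing order, padded to strictly
  -- increasing functions on ℕ.
  pos : ℕ → ℤ
  pos 0 = i₀
  pos 1 = i₁
  pos 2 = i₂
  pos 3 = i₃
  pos (suc (suc (suc (suc t)))) = ℤ.suc (pos (suc (suc (suc t))))
  pos-step : ∀ t → pos t ℤ.< pos (suc t)
  pos-step 0 = i₀<i₁
  pos-step 1 = i₁<i₂
  pos-step 2 = i₂<i₃
  pos-step (suc (suc (suc t))) = i<suc[i] _
  val : ℕ → ℤ
  val 0 = ℤ.pred (w i₂)
  val 1 = w i₂
  val 2 = w i₃
  val 3 = w i₀
  val 4 = w i₁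
  val (suc (suc (suc (suc (suc t))))) = ℤ.suc (val (suc (suc (suc (suc t)))))
  val-step : ∀ t → val t ℤ.< val (suc t)
  val-step 0 = ℤP.suc[i]≤j⇒i<j (ℤP.≤-reflexive (ℤP.suc-pred (w i₂)))
  val-step 1 = w₂<w₃
  val-step 2 = w₃<w₀
  val-step 3 = w₀<w₁
  val-step (suc (suc (suc (suc t)))) = i<suc[i] _

module Inversions (m : ℕ) (w : ℤ → ℤ) (periodic : ∀ i → w (i ℤ.+ + suc m) ≡ w i ℤ.+ + suc m)
                  (avoids3412 : Avoids p3412 w) where

  n : ℕ
  n = suc m

  i<i+n : ∀ i → i ℤ.< i ℤ.+ + n
  i<i+n i = subst (ℤ._< i ℤ.+ + n) (ℤP.+-identityʳ i) (ℤP.+-monoʳ-< i (+<+ (s≤s z≤n)))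

  w<w[+n] : ∀ i → w i ℤ.< w (i ℤ.+ + n)
  w<w[+n] i = subst (w i ℤ.<_) (sym (periodic i)) (i<i+n (w i))

  translates-contain-3412 : ∀ {i k} → i ℤ.+ + n ℤ.< k → w (k ℤ.+ + n) ℤ.< w i → Contains p3412 w
  translates-contain-3412 {i} {k} i+n<k w[k+n]<w[i] =
    contains-3412 w (i<i+n i) i+n<k (i<i+n k) (w<w[+n] k) w[k+n]<w[i] (w<w[+n] i)

  -- (A , s , q) encodes the inversion (1 + A , 1 + s + q n), both residues taken in [0, n).
  record ReducedInversion (A s q : ℕ) : Set where
    field
      A<n     : A < n
      s<n     : s < n
      A<s+qn  : A < s + q * n
      descent : w (+ suc (s + q * n)) ℤ.< w (+ suc A)

  open ReducedInversion

  descent-shifted : ∀ {A s q} → ReducedInversion A s q → w (+ suc s) ℤ.+ + (q * n) ℤ.< w (+ suc A)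
  descent-shifted {A} {s} {q} I =
    subst (ℤ._< w (+ suc A)) (periodic-multiple {w = w} periodic q (+ suc s)) (descent I)

  no-inversion-within-class : ∀ {A q} → ¬ ReducedInversion A A q
  no-inversion-within-class {A} {q} I =
    ℤP.<-irrefl refl (ℤP.≤-<-trans (ℤP.i≤i+j (w (+ suc A)) (+ (q * n))) (descent-shifted I))

  residues-distinct : ∀ {A s q} → ReducedInversion A s q → A ≢ s
  residues-distinct I refl = no-inversion-within-class I

  no-opposite-inversions : ∀ {A s q q′} → ReducedInversion A s q → ¬ ReducedInversion s A q′
  no-opposite-inversions {A} {s} {q} {q′} I J = ℤP.<-irrefl refl (begin-strict
    w (+ suc s)                  ≤⟨ ℤP.i≤i+j (w (+ suc s)) (+ (q * n)) ⟩
    w (+ suc s) ℤ.+ + (q * n)    <⟨ descent-shifted I ⟩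
    w (+ suc A)                  ≤⟨ ℤP.i≤i+j (w (+ suc A)) (+ (q′ * n)) ⟩
    w (+ suc A) ℤ.+ + (q′ * n)   <⟨ descent-shifted J ⟩
    w (+ suc s)                  ∎)
    where open ℤP.≤-Reasoning

  far-inversion-contains-3412 : ∀ {A s q} → ReducedInversion A s q →
    A + n + n < s + q * n → Contains p3412 w
  far-inversion-contains-3412 {A} {s} {zero} I far =
    contradiction far (ℕP.≤⇒≯ (begin
      s + 0 * n  ≡⟨ ℕP.+-identityʳ s ⟩
      s          ≤⟨ ℕP.<⇒≤ (s<n I) ⟩
      n          ≤⟨ ℕP.m≤n+m n (A + n) ⟩
      A + n + n  ∎))
    where open ℕP.≤-Reasoning
  far-inversion-contains-3412 {A} {s} {suc q} I far =
    translates-contain-3412 (+<+ (s≤s A+n<s+qn))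
      (subst (λ b → w b ℤ.< w (+ suc A)) (cong (λ t → + suc t) one-period-back) (descent I))
    where
    one-period-back : s + suc q * n ≡ s + q * n + n
    one-period-back = trans (cong (λ t → s + t) (ℕP.+-comm n (q * n))) (sym (ℕP.+-assoc s (q * n) n))
    A+n<s+qn : A + n < s + q * n
    A+n<s+qn = ℕP.+-cancelʳ-< n (A + n) (s + q * n) (subst (A + n + n <_) one-period-back far)

  inversion-span : ∀ {A s q} → ReducedInversion A s q → s + q * n < A + n + n
  inversion-span {A} {s} {q} I with ℕP.<-cmp (s + q * n) (A + n + n)
  ... | tri< near _ _ = near
  ... | tri≈ _ s+qn≡A+2n _ =
    contradiction (residue-injective q 2 (s<n I) (A<n I) (trans s+qn≡A+2n A+n+n≡A+2n)) (residues-distinct I ∘ sym)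
    where
    A+n+n≡A+2n : A + n + n ≡ A + 2 * n
    A+n+n≡A+2n = trans (ℕP.+-assoc A n n) (cong (λ t → A + (n + t)) (sym (ℕP.+-identityʳ n)))
  ... | tri> _ _ far = contradiction (far-inversion-contains-3412 I far) avoids3412

  -- An inversion is coded by its ordered pair of residues, swapped when it spans more than a period.
  code : ∀ {A s q} → ReducedInversion A s q → Fin (n * m)
  code {A} {s} {q} I with s + q * n <? A + n
  ... | yes _ = pairIndex (A<n I) (s<n I) (residues-distinct I)
  ... | no _  = pairIndex (s<n I) (A<n I) (residues-distinct I ∘ sym)

  code-injective : ∀ {A s q A′ s′ q′} (I : ReducedInversion A s q) (J : ReducedInversion A′ s′ q′) →
    code I ≡ code J → A ≡ A′ × s ≡ s′ × q ≡ q′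
  code-injective {A} {s} {q} {A′} {s′} {q′} I J eq
    with s + q * n <? A + n | s′ + q′ * n <? A′ + n
  ... | yes near | yes near′
    with pairIndex-injective (A<n I) (s<n I) (residues-distinct I)
                             (A<n J) (s<n J) (residues-distinct J) eq
  ...   | refl , refl = refl , refl ,
          quotient-unique-in-window (ℕP.<⇒≤ (A<s+qn I)) near (ℕP.<⇒≤ (A<s+qn J)) near′
  code-injective I J eq | no far | no far′
    with pairIndex-injective (s<n I) (A<n I) (residues-distinct I ∘ sym)
                             (s<n J) (A<n J) (residues-distinct J ∘ sym) eq
  ...   | refl , refl = refl , refl ,
          quotient-unique-in-window (ℕP.≮⇒≥ far) (inversion-span I) (ℕP.≮⇒≥ far′) (inversion-span J)
  code-injective I J eq | yes _ | no _
    with pairIndex-injective (A<n I) (s<n I) (residues-distinct I)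
                             (s<n J) (A<n J) (residues-distinct J ∘ sym) eq
  ...   | refl , refl = contradiction J (no-opposite-inversions I)
  code-injective I J eq | no _ | yes _
    with pairIndex-injective (s<n I) (A<n I) (residues-distinct I ∘ sym)
                             (A<n J) (s<n J) (residues-distinct J) eq
  ...   | refl , refl = contradiction I (no-opposite-inversions J)

  record Reduction (a b : ℤ) : Set where
    constructor reduction
    field
      {A s q}   : ℕ
      a≡1+A     : a ≡ + suc A
      b≡1+s+qn  : b ≡ + suc (s + q * n)
      inversion : ReducedInversion A s q

  reduce : ∀ {a b} → IsInversion n w (a , b) → Reduction a b
  reduce {+ suc A} {+ suc B} (_ , a≤n , a<b , w[b]<w[a]) =
    reduction {A = A} {s = B % n} {q = B / n} refl (cong (λ t → + suc t) B≡s+qn) record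
    { A<n     = ℤP.drop‿+≤+ a≤n
    ; s<n     = m%n<n B n
    ; A<s+qn  = subst (A <_) B≡s+qn (ℕP.≤-pred (ℤP.drop‿+<+ a<b))
    ; descent = subst (λ b → w b ℤ.< w (+ suc A)) (cong (λ t → + suc t) B≡s+qn) w[b]<w[a]
    }
    where
    B≡s+qn : B ≡ B % n + (B / n) * n
    B≡s+qn = m≡m%n+[m/n]*n B n
  reduce {+ zero}      (+≤+ () , _)
  reduce {ℤ.-[1+ _ ]}  (() , _)
  reduce {+ suc _} {+ zero}     (_ , _ , +<+ () , _)
  reduce {+ suc _} {ℤ.-[1+ _ ]} (_ , _ , () , _)

  inversionCode : ∀ x → IsInversion n w x → Fin (n * m)
  inversionCode _ inv = code (Reduction.inversion (reduce inv))

  inversionCode-injective : ∀ {x y} px py → inversionCode x px ≡ inversionCode y py → x ≡ y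
  inversionCode-injective px py eq with reduce px | reduce py
  ... | reduction refl refl I | reduction refl refl J with code-injective I J eq
  ...   | refl , refl , refl = refl

corollary7p1 : (n : ℕ) → 3 ≤ n → (w : ℤ → ℤ) → IsAffinePerm n w →
    Avoids p3412 w → Avoids p4231 w → LengthAtMost n w (2 * (n C 2))
corollary7p1 (suc m) _ w w∈S̃ avoids3412 _ xs unique inversions =
  subst (length xs ≤_) (sym (2*[1+m]C2≡[1+m]*m m))
    (length≤-of-injection inversionCode inversionCode-injective xs unique inversions)
  where open Inversions m w (IsAffinePerm.periodic w∈S̃) avoids3412
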